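{- Let $k\geq 4$ be even and let $\ell>k/2$ be odd. Then there is no partition $P$ of $V(C_k)$ such that $C_k/P$ contains exactly one odd cycle and this cycle has length $\ell$.
   Context: $C_k$ is the cycle of length $k$. For a graph $H$ and a partition $P=\{U_1,\dots,U_m\}$ of $V(H)$, the quotient graph $H/P$ has vertex set $P$, with $U_i,U_j$ adjacent (a loop if $i=j$) iff there are $u_i\in U_i,u_j\in U_j$ with $\{u_i,u_j\}\in E(H)$. -}

module Defs where

open import Data.Nat using (ℕ; zero; suc; _≤_; _<_; _*_)
open import Data.Nat.Divisibility using (_∣_)
open import Data.Fin using (Fin; toℕ)
open import Data.Product using (Σ; ∃; _×_; _,_)
open import Data.Sum using (_⊎_)
open import Relation.Nullary using (¬_)
open import Relation.Binary.PropositionalEquality using (_≡_)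

Even : ℕ → Set
Even n = 2 ∣ n

Odd : ℕ → Set
Odd n = ¬ (2 ∣ n)

Graph : ℕ → Set₁
Graph m = Fin m → Fin m → Set

-- The cycle C_k on vertex set Fin k = {0,…,k-1}: i ~ i+1 (mod k).
-- (This is the cycle graph C_k for k ≥ 3.)
CSucc : (k : ℕ) → Fin k → Fin k → Set
CSucc k u v = (toℕ v ≡ suc (toℕ u)) ⊎ ((suc (toℕ u) ≡ k) × (toℕ v ≡ 0))

C : (k : ℕ) → Graph k
C k u v = CSucc k u v ⊎ CSucc k v u

-- A partition P of V(H) = Fin k into m (nonempty) blocks, encoded as a
-- surjection f : Fin k → Fin m (block of u is f u).
Surj : {k m : ℕ} → (Fin k → Fin m) → Set
Surj {k} {m} f = (b : Fin m) → ∃ λ (a : Fin k) → f a ≡ b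

-- Quotient graph H/P: blocks a, b adjacent (loop if a = b) iff some edge of H
-- joins a vertex of a to a vertex of b.
Quot : {k m : ℕ} → Graph k → (Fin k → Fin m) → Graph m
Quot H f a b = ∃ λ u → ∃ λ v → H u v × f u ≡ a × f v ≡ b

Injective : {n m : ℕ} → (Fin n → Fin m) → Set
Injective c = ∀ i j → c i ≡ c j → i ≡ j

-- A loop is a cycle of length 1; for n ≥ 3 a cycle
-- of length n is an injective homomorphic image of C_n (vertex sequence
-- c 0, …, c (n-1) with consecutive (cyclically) vertices adjacent).
-- (G has no parallel edges, so there are no cycles of length 2.)
record Cycle {m : ℕ} (G : Graph m) (n : ℕ) : Set where
  field
    len-ok : (n ≡ 1) ⊎ (3 ≤ n)
    vert   : Fin n → Fin m
    inj    : Injective vert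
    adj    : ∀ i j → C n i j → G (vert i) (vert j)

-- for n = 1, C 1 has the single loop 0 ~ 0, so adj says G (vert 0) (vert 0).

CycleEdge : {m : ℕ} {G : Graph m} {n : ℕ} → Cycle G n → Fin m → Fin m → Set
CycleEdge {n = n} c u v =
  ∃ λ i → ∃ λ j → C n i j × Cycle.vert c i ≡ u × Cycle.vert c j ≡ v

-- Two cycles are the same (as subgraphs) iff they have the same edge set
-- (the vertex set is then determined as well).
SameCycle : {m : ℕ} {G : Graph m} {n n' : ℕ} → Cycle G n → Cycle G n' → Set
SameCycle {m} c c' =
  (u v : Fin m) → (CycleEdge c u v → CycleEdge c' u v) × (CycleEdge c' u v → CycleEdge c u v)

UniqueOddCycleOfLength : {m : ℕ} → Graph m → ℕ → Set
UniqueOddCycleOfLength G ℓ =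
  Odd ℓ × Σ (Cycle G ℓ) λ c → (n : ℕ) → Odd n → (c' : Cycle G n) → SameCycle c c'

-- Let c be the odd cycle of C_k/P and ℓ ≥ 3 its length. Every edge of c is the image of some edge
-- {p, p+1} of C_k, and each edge of C_k maps onto at most one edge of c; as k < 2ℓ, some edge e of c
-- is the image of exactly one edge {p₀, p₀+1}. Walking once around C_k from p₀+1 to p₀ therefore
-- gives a walk of length k − 1 in C_k/P that joins the ends of e without using e, and closing it up
-- along c − e gives a closed walk of length (k − 1) + (ℓ − 1), which is odd. An odd closed walk
-- contains an odd cycle, and this one avoids e, so it is not c.
module Submission where

open import Defs
open import Data.Nat using (ℕ; zero; suc; _+_; _∸_; _≤_; _<_; _*_; z≤n; s≤s; NonZero; _<?_)
open import Data.Nat.Properties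
open import Data.Nat.DivMod
open import Data.Nat.Induction using (<-rec)
open import Data.Nat.GeneralisedArithmetic using (fold)
open import Data.Nat.Divisibility using (_∣_; _∣?_; _∣0; ∣-refl; ∣m∣n⇒∣m+n; ∣m+n∣m⇒∣n)
open import Data.Fin as Fin using (Fin; toℕ)
import Data.Fin.Properties as Finₚ
open import Data.Product using (Σ; ∃; _×_; _,_; proj₁; proj₂)
open import Data.Sum using (_⊎_; inj₁; inj₂; reduce)
open import Function using (_∘_)
open import Data.Empty using (⊥; ⊥-elim)
open import Relation.Nullary using (¬_; Dec; yes; no)
open import Relation.Nullary.Decidable using (_×-dec_; _⊎-dec_; ¬?)
open import Relation.Binary.PropositionalEquality
open import Relation.Binary.Definitions using (Symmetric; DecidableEquality; tri<; tri≈; tri>)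

module _ {n : ℕ} .{{_ : NonZero n}} where

  next : Fin n → Fin n
  next p = suc (toℕ p) mod n

  toℕ-next : ∀ p → toℕ (next p) ≡ suc (toℕ p) % n
  toℕ-next p = Finₚ.toℕ-fromℕ< (m%n<n (suc (toℕ p)) n)

  suc-%-% : ∀ x → suc (x % n) % n ≡ suc x % n
  suc-%-% x = begin
    suc (x % n) % n         ≡⟨ %-distribˡ-+ 1 (x % n) n ⟩
    (1 % n + x % n % n) % n ≡⟨ cong (λ y → (1 % n + y) % n) (m%n%n≡m%n x n) ⟩
    (1 % n + x % n) % n     ≡⟨ %-distribˡ-+ 1 x n ⟨
    suc x % n               ∎
    where open ≡-Reasoning

  toℕ-fold-next : ∀ p s → toℕ (fold p next s) ≡ (s + toℕ p) % n
  toℕ-fold-next p zero = sym (m<n⇒m%n≡m (Finₚ.toℕ<n p))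
  toℕ-fold-next p (suc s) = begin
    toℕ (next (fold p next s))    ≡⟨ toℕ-next (fold p next s) ⟩
    suc (toℕ (fold p next s)) % n ≡⟨ cong (λ y → suc y % n) (toℕ-fold-next p s) ⟩
    suc ((s + toℕ p) % n) % n     ≡⟨ suc-%-% (s + toℕ p) ⟩
    suc (s + toℕ p) % n           ∎
    where open ≡-Reasoning

  fold-next-period : ∀ p → fold p next n ≡ p
  fold-next-period p = Finₚ.toℕ-injective (begin
    toℕ (fold p next n) ≡⟨ toℕ-fold-next p n ⟩
    (n + toℕ p) % n     ≡⟨ cong (_% n) (+-comm n (toℕ p)) ⟩
    (toℕ p + n) % n     ≡⟨ [m+n]%n≡m%n (toℕ p) n ⟩
    toℕ p % n           ≡⟨ m<n⇒m%n≡m (Finₚ.toℕ<n p) ⟩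
    toℕ p               ∎)
    where open ≡-Reasoning

  fold-next-≢ : ∀ p {s} → 0 < s → s < n → fold p next s ≢ p
  fold-next-≢ p {s} 0<s s<n eq = multiple-of-n ((s + toℕ p) / n) s≡q*n
    where
    open ≡-Reasoning
    [s+p]%n≡p : (s + toℕ p) % n ≡ toℕ p
    [s+p]%n≡p = trans (sym (toℕ-fold-next p s)) (cong toℕ eq)
    s≡q*n : s ≡ (s + toℕ p) / n * n
    s≡q*n = +-cancelʳ-≡ (toℕ p) s _ (begin
      s + toℕ p                             ≡⟨ m≡m%n+[m/n]*n (s + toℕ p) n ⟩
      (s + toℕ p) % n + (s + toℕ p) / n * n ≡⟨ cong (_+ (s + toℕ p) / n * n) [s+p]%n≡p ⟩
      toℕ p + (s + toℕ p) / n * n           ≡⟨ +-comm (toℕ p) _ ⟩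
      (s + toℕ p) / n * n + toℕ p           ∎)
    multiple-of-n : ∀ q → s ≡ q * n → ⊥
    multiple-of-n zero    s≡0     = <-irrefl (sym s≡0) 0<s
    multiple-of-n (suc q) s≡n+q*n = <⇒≱ s<n (subst (n ≤_) (sym s≡n+q*n) (m≤m+n n (q * n)))

  CSucc-next : ∀ p → CSucc n p (next p)
  CSucc-next p with suc (toℕ p) <? n
  ... | yes p+1<n = inj₁ (trans (toℕ-next p) (m<n⇒m%n≡m p+1<n))
  ... | no p+1≮n = inj₂ (p+1≡n , trans (toℕ-next p) (trans (cong (_% n) p+1≡n) (n%n≡0 n)))
    where
    p+1≡n : suc (toℕ p) ≡ n
    p+1≡n = ≤-antisym (Finₚ.toℕ<n p) (≮⇒≥ p+1≮n)

  CSucc⇒next : ∀ {u v} → CSucc n u v → v ≡ next u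
  CSucc⇒next {u} {v} (inj₁ v≡u+1) = Finₚ.toℕ-injective (begin
    toℕ v            ≡⟨ m<n⇒m%n≡m (Finₚ.toℕ<n v) ⟨
    toℕ v % n        ≡⟨ cong (_% n) v≡u+1 ⟩
    suc (toℕ u) % n  ≡⟨ toℕ-next u ⟨
    toℕ (next u)     ∎)
    where open ≡-Reasoning
  CSucc⇒next {u} {v} (inj₂ (u+1≡n , v≡0)) = Finₚ.toℕ-injective (begin
    toℕ v            ≡⟨ v≡0 ⟩
    0                ≡⟨ n%n≡0 n ⟨
    n % n            ≡⟨ cong (_% n) u+1≡n ⟨
    suc (toℕ u) % n  ≡⟨ toℕ-next u ⟨
    toℕ (next u)     ∎)
    where open ≡-Reasoning

SameEdge : {A : Set} → A → A → A → A → Set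
SameEdge a b x y = (a ≡ x × b ≡ y) ⊎ (a ≡ y × b ≡ x)

SameEdge? : {A : Set} → DecidableEquality A → (a b x y : A) → Dec (SameEdge a b x y)
SameEdge? _≟_ a b x y = ((a ≟ x) ×-dec (b ≟ y)) ⊎-dec ((a ≟ y) ×-dec (b ≟ x))

module _ {A : Set} {a b x y : A} where

  SameEdge-swap : SameEdge a b x y → SameEdge b a x y
  SameEdge-swap (inj₁ (a≡x , b≡y)) = inj₂ (b≡y , a≡x)
  SameEdge-swap (inj₂ (a≡y , b≡x)) = inj₁ (b≡x , a≡y)

  SameEdge-sym : SameEdge a b x y → SameEdge x y a b
  SameEdge-sym (inj₁ (a≡x , b≡y)) = inj₁ (sym a≡x , sym b≡y)
  SameEdge-sym (inj₂ (a≡y , b≡x)) = inj₂ (sym b≡x , sym a≡y)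

  SameEdge-trans : ∀ {u v} → SameEdge a b x y → SameEdge x y u v → SameEdge a b u v
  SameEdge-trans (inj₁ (a≡x , b≡y)) (inj₁ (x≡u , y≡v)) = inj₁ (trans a≡x x≡u , trans b≡y y≡v)
  SameEdge-trans (inj₁ (a≡x , b≡y)) (inj₂ (x≡v , y≡u)) = inj₂ (trans a≡x x≡v , trans b≡y y≡u)
  SameEdge-trans (inj₂ (a≡y , b≡x)) (inj₁ (x≡u , y≡v)) = inj₂ (trans a≡y y≡v , trans b≡x x≡u)
  SameEdge-trans (inj₂ (a≡y , b≡x)) (inj₂ (x≡v , y≡u)) = inj₁ (trans a≡y y≡u , trans b≡x x≡v)

C-sym : ∀ {n} → Symmetric (C n)
C-sym (inj₁ u→v) = inj₂ u→v
C-sym (inj₂ v→u) = inj₁ v→u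

Quot-sym : ∀ {k m} {H : Graph k} (f : Fin k → Fin m) → Symmetric H → Symmetric (Quot H f)
Quot-sym f H-sym (u , v , Huv , fu≡a , fv≡b) = v , u , H-sym Huv , fv≡b , fu≡a

RemoveEdge : ∀ {m} → Graph m → Fin m → Fin m → Graph m
RemoveEdge G x y a b = G a b × ¬ SameEdge a b x y

RemoveEdge-sym : ∀ {m} {G : Graph m} {x y} → Symmetric G → Symmetric (RemoveEdge G x y)
RemoveEdge-sym G-sym (Gab , ¬ab≈xy) = G-sym Gab , λ ba≈xy → ¬ab≈xy (SameEdge-swap ba≈xy)

module _ {m n : ℕ} {G : Graph m} where

  Cycle-map : ∀ {H : Graph m} → (∀ {a b} → G a b → H a b) → Cycle G n → Cycle H n
  Cycle-map G⇒H c = record { Cycle c ; adj = λ i j Cij → G⇒H (Cycle.adj c i j Cij) }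

  CycleEdge⇒adjacent : (c : Cycle G n) → ∀ {u v} → CycleEdge c u v → G u v
  CycleEdge⇒adjacent c (i , j , Cij , refl , refl) = Cycle.adj c i j Cij

  module _ .{{_ : NonZero n}} (c : Cycle G n) where
    open Cycle c

    edge : ∀ i → G (vert i) (vert (next i))
    edge i = adj i (next i) (inj₁ (CSucc-next i))

    edges-distinct : 3 ≤ n → ∀ {i j} →
      SameEdge (vert i) (vert (next i)) (vert j) (vert (next j)) → i ≡ j
    edges-distinct _ (inj₁ (i≈j , _)) = inj _ _ i≈j
    edges-distinct 3≤n {i} {j} (inj₂ (i≈j+1 , i+1≈j)) =
      ⊥-elim (fold-next-≢ j (s≤s z≤n) 3≤n (begin
        next (next j) ≡⟨ cong next (inj _ _ i≈j+1) ⟨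
        next i        ≡⟨ inj _ _ i+1≈j ⟩
        j             ∎))
      where open ≡-Reasoning

Odd⇒≡1⊎≥3 : ∀ {n} → Odd n → (n ≡ 1) ⊎ (3 ≤ n)
Odd⇒≡1⊎≥3 {0}                 odd = ⊥-elim (odd (2 ∣0))
Odd⇒≡1⊎≥3 {1}                 odd = inj₁ refl
Odd⇒≡1⊎≥3 {2}                 odd = ⊥-elim (odd ∣-refl)
Odd⇒≡1⊎≥3 {suc (suc (suc _))} odd = inj₂ (s≤s (s≤s (s≤s z≤n)))

Odd-+⇒Odd⊎Odd : ∀ a {b} → Odd (a + b) → Odd a ⊎ Odd b
Odd-+⇒Odd⊎Odd a odd with 2 ∣? a
... | yes 2∣a = inj₂ (λ 2∣b → odd (∣m∣n⇒∣m+n 2∣a 2∣b))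
... | no 2∤a  = inj₁ 2∤a

Even-suc∧Odd-suc⇒Odd-+ : ∀ {a b} → Even (suc a) → Odd (suc b) → Odd (a + b)
Even-suc∧Odd-suc⇒Odd-+ {a} {b} even odd 2∣a+b = odd (∣m+n∣m⇒∣n 2∣sum even)
  where
  2∣sum : 2 ∣ suc a + suc b
  2∣sum = subst (2 ∣_) (cong suc (sym (+-suc a b))) (∣m∣n⇒∣m+n ∣-refl 2∣a+b)

module Walks {m : ℕ} (R : Graph m) (R-sym : Symmetric R) where

  Steps : ℕ → (ℕ → Fin m) → Set
  Steps n w = ∀ t → t < n → R (w t) (w (suc t))

  -- Only vertex 0, …, vertex n are relevant; the sequence continues arbitrarily beyond n.
  record Walk (n : ℕ) (x y : Fin m) : Set where
    field
      vertex : ℕ → Fin m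
      steps  : Steps n vertex
      start  : vertex 0 ≡ x
      end    : vertex n ≡ y

  reverse : ∀ {n x y} → Walk n x y → Walk n y x
  reverse {n} W = record
    { vertex = λ t → vertex (n ∸ t)
    ; steps  = backwards
    ; start  = end
    ; end    = trans (cong vertex (n∸n≡0 n)) start
    }
    where
    open Walk W
    backwards : Steps n (λ t → vertex (n ∸ t))
    backwards t t<n = subst (λ s → R (vertex s) (vertex (n ∸ suc t))) n∸t≡
                            (R-sym (steps (n ∸ suc t) (subst (_≤ n) (sym n∸t≡) (m∸n≤m n t))))
      where
      n∸t≡ : suc (n ∸ suc t) ≡ n ∸ t
      n∸t≡ = sym (+-∸-assoc 1 t<n)

  splice : ℕ → (ℕ → Fin m) → (ℕ → Fin m) → ℕ → Fin m
  splice a w v t with t <? a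
  ... | yes _ = w t
  ... | no  _ = v (t ∸ a)

  splice-< : ∀ {a w v t} → t < a → splice a w v t ≡ w t
  splice-< {a} {t = t} t<a with t <? a
  ... | yes _   = refl
  ... | no  t≮a = ⊥-elim (t≮a t<a)

  splice-≥ : ∀ {a w v t} → a ≤ t → splice a w v t ≡ v (t ∸ a)
  splice-≥ {a} {t = t} a≤t with t <? a
  ... | yes t<a = ⊥-elim (<-irrefl refl (<-≤-trans t<a a≤t))
  ... | no  _   = refl

  _++_ : ∀ {a b x y z} → Walk a x y → Walk b y z → Walk (a + b) x z
  _++_ {a} {b} {x} {y} {z} W V = record
    { vertex = joined
    ; steps  = joined-steps
    ; start  = joined-start
    ; end    = trans (splice-≥ (m≤m+n a b)) (trans (cong V.vertex (m+n∸m≡n a b)) V.end)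
    }
    where
    module W = Walk W
    module V = Walk V
    joined : ℕ → Fin m
    joined = splice a W.vertex V.vertex

    joined-start : joined 0 ≡ x
    joined-start with 0 <? a
    ... | yes _   = W.start
    ... | no  0≮a = begin
      V.vertex (0 ∸ a) ≡⟨ cong V.vertex (0∸n≡0 a) ⟩
      V.vertex 0       ≡⟨ V.start ⟩
      y                ≡⟨ W.end ⟨
      W.vertex a       ≡⟨ cong W.vertex (n≤0⇒n≡0 (≮⇒≥ 0≮a)) ⟩
      W.vertex 0       ≡⟨ W.start ⟩
      x                ∎
      where open ≡-Reasoning

    joined-steps : Steps (a + b) joined
    joined-steps t t<a+b with <-cmp (suc t) a
    ... | tri< t+1<a _ _ = subst₂ R (sym (splice-< (<-trans (n<1+n t) t+1<a))) (sym (splice-< t+1<a))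
                                   (W.steps t (<-trans (n<1+n t) t+1<a))
    ... | tri≈ _ t+1≡a _ = subst₂ R (sym (splice-< t<a)) (sym crossing) (W.steps t t<a)
      where
      open ≡-Reasoning
      t<a : t < a
      t<a = ≤-reflexive t+1≡a
      crossing : joined (suc t) ≡ W.vertex (suc t)
      crossing = begin
        joined (suc t)         ≡⟨ splice-≥ (≤-reflexive (sym t+1≡a)) ⟩
        V.vertex (suc t ∸ a)   ≡⟨ cong (λ s → V.vertex (s ∸ a)) t+1≡a ⟩
        V.vertex (a ∸ a)       ≡⟨ cong V.vertex (n∸n≡0 a) ⟩
        V.vertex 0             ≡⟨ V.start ⟩
        y                      ≡⟨ W.end ⟨
        W.vertex a             ≡⟨ cong W.vertex t+1≡a ⟨
        W.vertex (suc t)       ∎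
    ... | tri> _ _ a<t+1 = subst₂ R (sym (splice-≥ a≤t)) (sym after)
                                   (V.steps (t ∸ a) (subst (t ∸ a <_) (m+n∸m≡n a b) (∸-monoˡ-< t<a+b a≤t)))
      where
      a≤t : a ≤ t
      a≤t = ≤-pred a<t+1
      after : joined (suc t) ≡ V.vertex (suc (t ∸ a))
      after = trans (splice-≥ (m≤n⇒m≤1+n a≤t)) (cong V.vertex (+-∸-assoc 1 a≤t))

  segment : ∀ {n w a b} → Steps n w → a ≤ b → b ≤ n → Walk (b ∸ a) (w a) (w b)
  segment {n} {w} {a} {b} w-steps a≤b b≤n = record
    { vertex = λ t → w (a + t)
    ; steps  = λ t t<b∸a → subst (λ s → R (w (a + t)) (w s)) (sym (+-suc a t))
                 (w-steps (a + t) (<-≤-trans (subst (a + t <_) (m+[n∸m]≡n a≤b) (+-monoʳ-< a t<b∸a)) b≤n))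
    ; start  = cong w (+-identityʳ a)
    ; end    = cong w (m+[n∸m]≡n a≤b)
    }

  ClosedWalk⇒Cycle : ∀ {n x} (W : Walk n x x) → (n ≡ 1) ⊎ (3 ≤ n) →
    (∀ (i j : Fin n) → Walk.vertex W (toℕ i) ≡ Walk.vertex W (toℕ j) → i ≡ j) → Cycle R n
  ClosedWalk⇒Cycle {n} W n-ok injective = record
    { len-ok = n-ok
    ; vert   = λ i → vertex (toℕ i)
    ; inj    = injective
    ; adj    = λ { i j (inj₁ i→j) → step i→j ; i j (inj₂ j→i) → R-sym (step j→i) }
    }
    where
    open Walk W
    step : ∀ {i j} → CSucc n i j → R (vertex (toℕ i)) (vertex (toℕ j))
    step {i} (inj₁ j≡i+1) =
      subst (λ s → R (vertex (toℕ i)) (vertex s)) (sym j≡i+1) (steps (toℕ i) (Finₚ.toℕ<n i))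
    step {i} {j} (inj₂ (i+1≡n , j≡0)) =
      subst (R (vertex (toℕ i))) wraps (steps (toℕ i) (Finₚ.toℕ<n i))
      where
      open ≡-Reasoning
      wraps : vertex (suc (toℕ i)) ≡ vertex (toℕ j)
      wraps = begin
        vertex (suc (toℕ i)) ≡⟨ cong vertex i+1≡n ⟩
        vertex n             ≡⟨ trans end (sym start) ⟩
        vertex 0             ≡⟨ cong vertex j≡0 ⟨
        vertex (toℕ j)       ∎

  split-at-repetition : ∀ {n x a b} (W : Walk n x x) → a < b → b ≤ n →
    Walk.vertex W a ≡ Walk.vertex W b →
    Walk (b ∸ a) (Walk.vertex W a) (Walk.vertex W a) × Walk (a + (n ∸ b)) x x
  split-at-repetition {n} {x} {a} {b} W a<b b≤n a≈b =
      subst (Walk _ _) (sym a≈b) (segment steps (<⇒≤ a<b) b≤n)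
    , subst₂ (Walk _) start end (segment steps z≤n a≤n ++ from-a)
    where
    open Walk W
    a≤n : a ≤ n
    a≤n = ≤-trans (<⇒≤ a<b) b≤n
    from-a : Walk (n ∸ b) (vertex a) (vertex n)
    from-a = subst (λ v → Walk (n ∸ b) v (vertex n)) (sym a≈b) (segment steps b≤n ≤-refl)

  Repetition : ℕ → (ℕ → Fin m) → Set
  Repetition n w = ∃ λ (i : Fin n) → ∃ λ (j : Fin n) → toℕ i < toℕ j × w (toℕ i) ≡ w (toℕ j)

  repetition? : ∀ n w → Dec (Repetition n w)
  repetition? n w = Finₚ.any? λ i → Finₚ.any? λ j → (toℕ i <? toℕ j) ×-dec (w (toℕ i) Finₚ.≟ w (toℕ j))

  ¬Repetition⇒injective : ∀ {n w} → ¬ Repetition n w → ∀ (i j : Fin n) → w (toℕ i) ≡ w (toℕ j) → i ≡ j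
  ¬Repetition⇒injective none i j i≈j with <-cmp (toℕ i) (toℕ j)
  ... | tri< i<j _ _ = ⊥-elim (none (i , j , i<j , i≈j))
  ... | tri≈ _ i≡j _ = Finₚ.toℕ-injective i≡j
  ... | tri> _ _ j<i = ⊥-elim (none (j , i , j<i , sym i≈j))

  repetition⇒shorter-oddClosedWalk : ∀ {n x} → Odd n → (W : Walk n x x) → Repetition n (Walk.vertex W) →
    ∃ λ n' → n' < n × Odd n' × ∃ λ y → Walk n' y y
  repetition⇒shorter-oddClosedWalk {n} {x} odd W (i , j , a<b , a≈b) =
    shorter (Odd-+⇒Odd⊎Odd (b ∸ a) (subst Odd (sym lengths) odd))
    where
    a b : ℕ
    a = toℕ i
    b = toℕ j
    b≤n : b ≤ n
    b≤n = <⇒≤ (Finₚ.toℕ<n j)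
    lengths : (b ∸ a) + (a + (n ∸ b)) ≡ n
    lengths = trans (sym (+-assoc (b ∸ a) a (n ∸ b)))
                    (trans (cong (_+ (n ∸ b)) (m∸n+n≡m (<⇒≤ a<b))) (m+[n∸m]≡n b≤n))
    halves : Walk (b ∸ a) (Walk.vertex W a) (Walk.vertex W a) × Walk (a + (n ∸ b)) x x
    halves = split-at-repetition W a<b b≤n a≈b
    shorter : Odd (b ∸ a) ⊎ Odd (a + (n ∸ b)) → ∃ λ n' → n' < n × Odd n' × ∃ λ y → Walk n' y y
    shorter (inj₁ odd-loop) =
      b ∸ a , ≤-<-trans (m∸n≤m b a) (Finₚ.toℕ<n j) , odd-loop , _ , proj₁ halves
    shorter (inj₂ odd-rest) =
      a + (n ∸ b) , subst (a + (n ∸ b) <_) (m+[n∸m]≡n b≤n) (+-monoˡ-< (n ∸ b) a<b) ,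
      odd-rest , _ , proj₂ halves

  OddCycle : Set
  OddCycle = ∃ λ n → Odd n × Cycle R n

  oddClosedWalk⇒oddCycle : ∀ n {x} → Odd n → Walk n x x → OddCycle
  oddClosedWalk⇒oddCycle = <-rec (λ n → ∀ {x} → Odd n → Walk n x x → OddCycle) shorten
    where
    shorten : ∀ n → (∀ {n'} → n' < n → ∀ {x} → Odd n' → Walk n' x x → OddCycle) →
              ∀ {x} → Odd n → Walk n x x → OddCycle
    shorten n rec odd W with repetition? n (Walk.vertex W)
    ... | no none =
      n , odd , ClosedWalk⇒Cycle W (Odd⇒≡1⊎≥3 odd) (¬Repetition⇒injective {w = Walk.vertex W} none)
    ... | yes rep with repetition⇒shorter-oddClosedWalk odd W rep
    ...   | _ , shorter , odd′ , _ , W′ = rec shorter odd′ W′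

  walk-around : ∀ {N} (g : Fin (suc N) → Fin m) (p : Fin (suc N)) →
    (∀ q → q ≢ p → R (g q) (g (next q))) → Walk N (g (next p)) (g p)
  walk-around g p step = record
    { vertex = λ s → g (fold p next (suc s))
    ; steps  = λ s s<N → step _ (fold-next-≢ p (s≤s z≤n) (s≤s s<N))
    ; start  = refl
    ; end    = cong g (fold-next-period p)
    }

DoublyCovered : ∀ {k ℓ} → (Fin k → Fin ℓ → Set) → Fin ℓ → Set
DoublyCovered Cov i = ∃ λ p → ∃ λ p′ → p ≢ p′ × Cov p i × Cov p′ i

doublyCovered⇒≤ : ∀ {k ℓ} {Cov : Fin k → Fin ℓ → Set} → (∀ {p i j} → Cov p i → Cov p j → i ≡ j) →
  (∀ i → DoublyCovered Cov i) → ℓ + ℓ ≤ k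
doublyCovered⇒≤ {k} {ℓ} {Cov} functional doubly = Finₚ.injective⇒≤ {f = cover ∘ Fin.splitAt ℓ}
  (λ {x} {y} e → splitAt-injective x y (cover-injective _ _ e))
  where
  cover : Fin ℓ ⊎ Fin ℓ → Fin k
  cover (inj₁ i) = proj₁ (doubly i)
  cover (inj₂ i) = proj₁ (proj₂ (doubly i))

  covers : ∀ s → Cov (cover s) (reduce s)
  covers (inj₁ i) = proj₁ (proj₂ (proj₂ (proj₂ (doubly i))))
  covers (inj₂ i) = proj₂ (proj₂ (proj₂ (proj₂ (doubly i))))

  distinct : ∀ i → cover (inj₁ i) ≢ cover (inj₂ i)
  distinct i = proj₁ (proj₂ (proj₂ (doubly i)))

  same-target : ∀ s s′ → cover s ≡ cover s′ → reduce s ≡ reduce s′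
  same-target s s′ e = functional (covers s) (subst (λ p → Cov p (reduce s′)) (sym e) (covers s′))

  cover-injective : ∀ s s′ → cover s ≡ cover s′ → s ≡ s′
  cover-injective (inj₁ i) (inj₁ i′) e = cong inj₁ (same-target (inj₁ i) (inj₁ i′) e)
  cover-injective (inj₂ i) (inj₂ i′) e = cong inj₂ (same-target (inj₂ i) (inj₂ i′) e)
  cover-injective (inj₁ i) (inj₂ i′) e with same-target (inj₁ i) (inj₂ i′) e
  ... | refl = ⊥-elim (distinct i e)
  cover-injective (inj₂ i) (inj₁ i′) e with same-target (inj₂ i) (inj₁ i′) e
  ... | refl = ⊥-elim (distinct i (sym e))

  splitAt-injective : ∀ x y → Fin.splitAt ℓ x ≡ Fin.splitAt ℓ y → x ≡ y
  splitAt-injective x y e = begin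
    x                            ≡⟨ Finₚ.join-splitAt ℓ ℓ x ⟨
    Fin.join ℓ ℓ (Fin.splitAt ℓ x) ≡⟨ cong (Fin.join ℓ ℓ) e ⟩
    Fin.join ℓ ℓ (Fin.splitAt ℓ y) ≡⟨ Finₚ.join-splitAt ℓ ℓ y ⟩
    y                            ∎
    where open ≡-Reasoning

module _ {m K L : ℕ} (f : Fin (suc K) → Fin m) (c : Cycle (Quot (C (suc K)) f) (suc L)) where
  open Cycle c

  Covers : Fin (suc K) → Fin (suc L) → Set
  Covers p i = SameEdge (f p) (f (next p)) (vert i) (vert (next i))

  covers? : ∀ p i → Dec (Covers p i)
  covers? p i = SameEdge? Finₚ._≟_ (f p) (f (next p)) (vert i) (vert (next i))

  every-edge-covered : ∀ i → ∃ λ p → Covers p i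
  every-edge-covered i with edge c i
  ... | u , v , inj₁ u→v , fu≡ , fv≡ = u , inj₁ (fu≡ , trans (cong f (sym (CSucc⇒next u→v))) fv≡)
  ... | u , v , inj₂ v→u , fu≡ , fv≡ = v , inj₂ (fv≡ , trans (cong f (sym (CSucc⇒next v→u))) fu≡)

  covers-functional : 3 ≤ suc L → ∀ {p i j} → Covers p i → Covers p j → i ≡ j
  covers-functional 3≤ℓ p-covers-i p-covers-j =
    edges-distinct c 3≤ℓ (SameEdge-trans (SameEdge-sym p-covers-i) p-covers-j)

  uniquely-covered-edge : 3 ≤ suc L → suc K < 2 * suc L →
    ∃ λ i → ∃ λ p₀ → Covers p₀ i × (∀ p → Covers p i → p ≡ p₀)
  uniquely-covered-edge 3≤ℓ k<2ℓ
    with Finₚ.¬∀⟶∃¬ (suc L) (DoublyCovered Covers) doubly? not-all-doubly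
    where
    doubly? : ∀ i → Dec (DoublyCovered Covers i)
    doubly? i = Finₚ.any? λ p → Finₚ.any? λ p′ → ¬? (p Finₚ.≟ p′) ×-dec (covers? p i ×-dec covers? p′ i)
    not-all-doubly : ¬ (∀ i → DoublyCovered Covers i)
    not-all-doubly all = <⇒≱ k<2ℓ (subst (_≤ suc K) (cong (suc L +_) (sym (+-identityʳ (suc L))))
                                    (doublyCovered⇒≤ (covers-functional 3≤ℓ) all))
  ... | i , not-doubly = i , p₀ , p₀-covers , unique
    where
    p₀ : Fin (suc K)
    p₀ = proj₁ (every-edge-covered i)
    p₀-covers : Covers p₀ i
    p₀-covers = proj₂ (every-edge-covered i)
    unique : ∀ p → Covers p i → p ≡ p₀
    unique p p-covers with p Finₚ.≟ p₀
    ... | yes p≡p₀ = p≡p₀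
    ... | no  p≢p₀ = ⊥-elim (not-doubly (p , p₀ , p≢p₀ , p-covers , p₀-covers))

  uniquely-covered⇒avoiding-odd-cycle : 3 ≤ suc L → Even (suc K) → Odd (suc L) →
    ∀ {i p₀} → Covers p₀ i → (∀ p → Covers p i → p ≡ p₀) →
    ∃ λ n → Odd n × Σ (Cycle (Quot (C (suc K)) f) n) λ c′ → ¬ CycleEdge c′ (vert i) (vert (next i))
  uniquely-covered⇒avoiding-odd-cycle 3≤ℓ even-k odd-ℓ {i} {p₀} p₀-covers unique =
    let n , odd-n , c′ = oddClosedWalk⇒oddCycle (K + L) odd-length (proj₂ (closed p₀-covers))
    in  n , odd-n , Cycle-map proj₁ c′ , λ i-edge → proj₂ (CycleEdge⇒adjacent c′ i-edge) (inj₁ (refl , refl))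
    where
    open Walks (RemoveEdge (Quot (C (suc K)) f) (vert i) (vert (next i))) (RemoveEdge-sym (Quot-sym f C-sym))

    rim : Walk K (f (next p₀)) (f p₀)
    rim = walk-around f p₀ λ q q≢p₀ →
      (q , next q , inj₁ (CSucc-next q) , refl , refl) , λ q-covers → q≢p₀ (unique q q-covers)

    arc : Walk L (vert (next i)) (vert i)
    arc = walk-around vert i λ j j≢i → edge c j , λ same → j≢i (edges-distinct c 3≤ℓ same)

    closed : Covers p₀ i → ∃ λ x → Walk (K + L) x x
    closed (inj₁ (fp₀≡ , fnp₀≡)) = _ , subst₂ (Walk K) fnp₀≡ fp₀≡ rim ++ reverse arc
    closed (inj₂ (fp₀≡ , fnp₀≡)) = _ , subst₂ (Walk K) fnp₀≡ fp₀≡ rim ++ arc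

    odd-length : Odd (K + L)
    odd-length = Even-suc∧Odd-suc⇒Odd-+ even-k odd-ℓ

lemma4p3 : (k ℓ : ℕ) → 4 ≤ k → Even k → Odd ℓ → k < 2 * ℓ →
    (m : ℕ) (f : Fin k → Fin m) → Surj f →
    ¬ UniqueOddCycleOfLength (Quot (C k) f) ℓ
lemma4p3 _ 0 _ _ odd-ℓ = ⊥-elim (odd-ℓ (2 ∣0))
lemma4p3 _ 1 4≤k _ _ k<2 = ⊥-elim (<⇒≱ k<2 (≤-trans (s≤s (s≤s z≤n)) 4≤k))
lemma4p3 _ 2 _ _ odd-ℓ = ⊥-elim (odd-ℓ ∣-refl)
lemma4p3 (suc _) (suc (suc (suc _))) _ even-k odd-ℓ k<2ℓ _ f _ (_ , c , unique) =
  let 3≤ℓ                          = s≤s (s≤s (s≤s z≤n))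
      i , p₀ , p₀-covers , only-p₀ = uniquely-covered-edge f c 3≤ℓ k<2ℓ
      n , odd-n , c′ , avoids-i    = uniquely-covered⇒avoiding-odd-cycle f c 3≤ℓ even-k odd-ℓ p₀-covers only-p₀
  in  avoids-i (proj₁ (unique n odd-n c′ (vert i) (vert (next i)))
                      (i , next i , inj₁ (CSucc-next i) , refl , refl))
  where open Cycle c
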